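{- Let $G$ be a graph on $V=\{0,1\}^n$ such that for some $D\subseteq\{1,\dots,n\}$, two vertices $x,y$ are adjacent iff their Hamming distance $d_H(x,y)$ lies in $D$. Let $I\subseteq V$ be an independent set in $G$. Then for every integer $s\ge 3$, \[ \alpha_s(G) \ge (s-1)\,|I|\left(1-\frac{s-2}{2}\cdot\frac{|I|}{2^n}\right). \] In particular, for a sequence of such graphs (with $n\to\infty$ and $s$ fixed) with $\alpha(G)=o(2^n)$, one has $\alpha_s(G)\ge (s-1+o(1))\,\alpha(G)$.
   Context: $d_H(x,y)=|\{i: x_i\ne y_i\}|$ is the Hamming distance. For a graph $G$, $\alpha_s(G)$ denotes the maximum size of a vertex set $S$ such that $G[S]$ contains no copy of $K_s$, and $\alpha(G)$ is the independence number. -}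

module Defs where

open import Data.Nat using (ℕ; zero; suc; _+_; _≤_)
open import Data.Bool using (Bool; true; false; _xor_; if_then_else_)
open import Data.Vec using (Vec; []; _∷_)
open import Data.List using (List; length)
open import Data.List.Membership.Propositional using (_∈_)
open import Data.List.Relation.Unary.All using (All)
open import Data.List.Relation.Unary.AllPairs using (AllPairs)
open import Data.Product using (Σ; _×_)
open import Relation.Binary.PropositionalEquality using (_≡_)
open import Relation.Nullary using (¬_)

Cube : ℕ → Set
Cube n = Vec Bool n

hamming : ∀ {n} → Cube n → Cube n → ℕ
hamming [] [] = 0
hamming (a ∷ x) (b ∷ y) = (if a xor b then 1 else 0) + hamming x y

DistSet : ℕ → List ℕ → Set
DistSet n D = All (λ d → 1 ≤ d × d ≤ n) D

Adj : ∀ {n} → List ℕ → Cube n → Cube n → Set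
Adj D x y = hamming x y ∈ D

Independent : ∀ {n} → List ℕ → List (Cube n) → Set
Independent D I = ∀ {x y} → x ∈ I → y ∈ I → ¬ Adj D x y

-- G[S] contains a copy of K_s: s vertices of S, pairwise adjacent
-- (hence distinct, since adjacency is irreflexive as 0 ∉ D).
ContainsK : ∀ {n} → List ℕ → ℕ → List (Cube n) → Set
ContainsK D s S =
  Σ (List (Cube _)) λ C → length C ≡ s × All (_∈ S) C × AllPairs (Adj D) C

-- A graph on {0,1}^n defined by Hamming distances is invariant under every
-- translation x ↦ x ⊕ t, so each translate I ⊕ t of an independent set is
-- independent. Grow U greedily as a union of translates of I: a clique meets
-- each translate at most once, so after j steps G[U] has no K_(j+1). Since
-- ∑_t |(I ⊕ t) ∩ U| = |I| |U|, some translate meets U in at most |I| |U| / 2^n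
-- points, so with |U| ≤ j |I| the step adds at least |I| - j |I|² / 2^n new
-- vertices. Summing over j = 0, …, s - 2 gives
-- |U| ≥ (s - 1) |I| - (s - 1) (s - 2) |I|² / 2^(n+1).
module Submission where

open import Defs
open import Data.Bool using (true; false; _xor_; if_then_else_)
open import Data.Bool.Properties using (xor-assoc; xor-comm; xor-same; xor-identityʳ)
import Data.Bool.Properties as Bool
open import Data.Empty using (⊥-elim)
open import Data.List using (List; []; _∷_; length; map; filter; _++_)
open import Data.List.Membership.Propositional using (_∈_; _∉_)
open import Data.List.Membership.Propositional.Properties using (∈-map⁻; ∈-++⁻; ∈-filter⁻)
import Data.List.Membership.DecPropositional as DecMembership
open import Data.List.Properties using (length-++; length-map)
open import Data.List.Relation.Unary.All using (All; []; _∷_) renaming (zipWith to All-zipWith)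
import Data.List.Relation.Unary.All.Properties as All
open import Data.List.Relation.Unary.AllPairs using (AllPairs; []; _∷_)
import Data.List.Relation.Unary.AllPairs.Properties as AllPairs
open import Data.List.Relation.Unary.Unique.Propositional using (Unique)
import Data.List.Relation.Unary.Unique.Propositional.Properties as Unique
open import Data.Nat using (ℕ; zero; suc; _+_; _*_; _∸_; _^_; _≤_; z≤n; s≤s; _≤?_)
open import Data.Nat.Properties
open import Algebra.Properties.CommutativeSemigroup +-commutativeSemigroup
  using () renaming (interchange to +-interchange)
open import Data.Nat.Tactic.RingSolver using (solve-∀)
open import Data.Product using (Σ; _×_; _,_; proj₁; proj₂; ∃)
open import Data.Sum using ([_,_]′)
open import Data.Vec using ([]; _∷_; zipWith)
open import Data.Vec.Properties using (≡-dec)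
open import Function using (_∘_; id)
open import Level using (Level)
open import Relation.Binary.Core using (Rel)
open import Relation.Binary.Definitions using (DecidableEquality)
open import Relation.Binary.PropositionalEquality
open import Relation.Nullary using (¬_; Dec; yes; no; does; _⊎-dec_)
open import Relation.Unary using (Decidable)
open import Relation.Unary.Properties using (∁?)

private
  variable
    a p q r : Level
    A : Set a

indicator : {P : Set p} → Dec P → ℕ
indicator P? = if does P? then 1 else 0

indicator-⊎ : {P : Set p} {Q : Set q} (P? : Dec P) (Q? : Dec Q) →
  ¬ (P × Q) → indicator (P? ⊎-dec Q?) ≡ indicator P? + indicator Q?
indicator-⊎ (yes p) (yes q) ¬both = ⊥-elim (¬both (p , q))
indicator-⊎ (yes _) (no _)  _     = refl
indicator-⊎ (no _)  _       _     = refl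

module _ {P : A → Set p} (P? : Decidable P) where

  length-filter-∷ : ∀ x xs →
    length (filter P? (x ∷ xs)) ≡ indicator (P? x) + length (filter P? xs)
  length-filter-∷ x xs with does (P? x)
  ... | true  = refl
  ... | false = refl

  length-filter-+-filter-∁ : ∀ xs →
    length (filter P? xs) + length (filter (∁? P?) xs) ≡ length xs
  length-filter-+-filter-∁ []       = refl
  length-filter-+-filter-∁ (x ∷ xs) with P? x
  ... | yes _ = cong suc (length-filter-+-filter-∁ xs)
  ... | no  _ = trans (+-suc _ _) (cong suc (length-filter-+-filter-∁ xs))

module _ (_≟_ : DecidableEquality A) where
  open DecMembership _≟_ using (_∈?_)

  -- `v ∈? u ∷ U` unfolds to `(v ≟ u) ⊎-dec (v ∈? U)` under a `map′`, which keeps `does`.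
  indicator-∈-∷ : ∀ {u U} → u ∉ U → ∀ v →
    indicator (v ∈? u ∷ U) ≡ indicator (v ≟ u) + indicator (v ∈? U)
  indicator-∈-∷ {u} {U} u∉U v =
    indicator-⊎ (v ≟ u) (v ∈? U) (λ (v≡u , v∈U) → u∉U (subst (_∈ U) v≡u v∈U))

module _ (R : Rel A r) where

  CliqueNumber≤ : ℕ → List A → Set _
  CliqueNumber≤ j U = ∀ C → All (_∈ U) C → AllPairs R C → length C ≤ j

  cliqueNumber≤-[] : CliqueNumber≤ 0 []
  cliqueNumber≤-[] []      _        _ = z≤n
  cliqueNumber≤-[] (_ ∷ _) (() ∷ _) _

  independent⇒cliqueNumber≤1 : ∀ {T} → (∀ {x y} → x ∈ T → y ∈ T → ¬ R x y) → CliqueNumber≤ 1 T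
  independent⇒cliqueNumber≤1 indep []          _                _               = z≤n
  independent⇒cliqueNumber≤1 indep (_ ∷ [])    _                _               = s≤s z≤n
  independent⇒cliqueNumber≤1 indep (_ ∷ _ ∷ _) (x∈T ∷ y∈T ∷ _) ((Rxy ∷ _) ∷ _) = ⊥-elim (indep x∈T y∈T Rxy)

  module _ (_≟_ : DecidableEquality A) where
    open DecMembership _≟_ using (_∈?_)

    cliqueNumber≤-++ : ∀ {i j U T} → CliqueNumber≤ i U → CliqueNumber≤ j T → CliqueNumber≤ (i + j) (U ++ T)
    cliqueNumber≤-++ {i} {j} {U} {T} ωU ωT C C⊆U++T clique = begin
      length C
        ≡⟨ length-filter-+-filter-∁ (_∈? U) C ⟨
      length (filter (_∈? U) C) + length (filter (∁? (_∈? U)) C)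
        ≤⟨ +-mono-≤ (ωU _ (All.all-filter (_∈? U) C) (AllPairs.filter⁺ (_∈? U) clique))
                    (ωT _ outside-U⊆T (AllPairs.filter⁺ (∁? (_∈? U)) clique)) ⟩
      i + j ∎
      where
      open ≤-Reasoning
      ∈-++-∉ : ∀ {v} → v ∈ U ++ T × v ∉ U → v ∈ T
      ∈-++-∉ (v∈U++T , v∉U) = [ ⊥-elim ∘ v∉U , id ]′ (∈-++⁻ U v∈U++T)
      outside-U⊆T : All (_∈ T) (filter (∁? (_∈? U)) C)
      outside-U⊆T = All-zipWith ∈-++-∉
        (All.filter⁺ (∁? (_∈? U)) C⊆U++T , All.all-filter (∁? (_∈? U)) C)

twice-≤-+ : ∀ N {x y A B} → x ≤ y → N * x ≤ A → N * y ≤ B → 2 * N * x ≤ A + B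
twice-≤-+ N {x} x≤y Nx≤A Ny≤B = begin
  2 * N * x     ≡⟨ double N x ⟩
  N * x + N * x ≤⟨ +-mono-≤ Nx≤A (≤-trans (*-monoʳ-≤ N x≤y) Ny≤B) ⟩
  _             ∎
  where
  open ≤-Reasoning
  double : ∀ N x → 2 * N * x ≡ N * x + N * x
  double = solve-∀

_≟ᶜ_ : ∀ {n} → DecidableEquality (Cube n)
_≟ᶜ_ = ≡-dec Bool._≟_

open module CubeMembership {n} = DecMembership (_≟ᶜ_ {n}) using (_∈?_; _∉?_)

_⊕_ : ∀ {n} → Cube n → Cube n → Cube n
_⊕_ = zipWith _xor_

xor-involutiveʳ : ∀ a c → (a xor c) xor c ≡ a
xor-involutiveʳ a c = trans (xor-assoc a c c) (trans (cong (a xor_) (xor-same c)) (xor-identityʳ a))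

xor-cancelʳ : ∀ a b c → (a xor c) xor (b xor c) ≡ a xor b
xor-cancelʳ a b c = begin
  (a xor c) xor (b xor c) ≡⟨ cong ((a xor c) xor_) (xor-comm b c) ⟩
  (a xor c) xor (c xor b) ≡⟨ xor-assoc (a xor c) c b ⟨
  ((a xor c) xor c) xor b ≡⟨ cong (_xor b) (xor-involutiveʳ a c) ⟩
  a xor b                 ∎
  where open ≡-Reasoning

⊕-involutiveʳ : ∀ {n} (x t : Cube n) → (x ⊕ t) ⊕ t ≡ x
⊕-involutiveʳ []      []      = refl
⊕-involutiveʳ (a ∷ x) (c ∷ t) = cong₂ _∷_ (xor-involutiveʳ a c) (⊕-involutiveʳ x t)

⊕-cancelʳ : ∀ {n} (t : Cube n) {x y : Cube n} → x ⊕ t ≡ y ⊕ t → x ≡ y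
⊕-cancelʳ t {x} {y} eq = begin
  x           ≡⟨ ⊕-involutiveʳ x t ⟨
  (x ⊕ t) ⊕ t ≡⟨ cong (_⊕ t) eq ⟩
  (y ⊕ t) ⊕ t ≡⟨ ⊕-involutiveʳ y t ⟩
  y           ∎
  where open ≡-Reasoning

hamming-⊕-invariant : ∀ {n} (x y t : Cube n) → hamming (x ⊕ t) (y ⊕ t) ≡ hamming x y
hamming-⊕-invariant []      []      []      = refl
hamming-⊕-invariant (a ∷ x) (b ∷ y) (c ∷ t) =
  cong₂ (λ d h → (if d then 1 else 0) + h) (xor-cancelʳ a b c) (hamming-⊕-invariant x y t)

independent-map-⊕ : ∀ {n D} {I : List (Cube n)} → Independent D I → ∀ t → Independent D (map (_⊕ t) I)
independent-map-⊕ {D = D} indep t v∈ w∈ adj with ∈-map⁻ (_⊕ t) v∈ | ∈-map⁻ (_⊕ t) w∈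
... | x , x∈I , refl | y , y∈I , refl = indep x∈I y∈I (subst (_∈ D) (hamming-⊕-invariant x y t) adj)

cliqueNumber≤⇒¬ContainsK : ∀ {n D j} {U : List (Cube n)} → CliqueNumber≤ (Adj D) j U → ¬ ContainsK D (suc j) U
cliqueNumber≤⇒¬ContainsK ωU (C , length≡ , C⊆U , clique) = 1+n≰n (subst (_≤ _) length≡ (ωU C C⊆U clique))

sumCube : ∀ n → (Cube n → ℕ) → ℕ
sumCube zero    g = g []
sumCube (suc n) g = sumCube n (g ∘ (false ∷_)) + sumCube n (g ∘ (true ∷_))

sumCube-cong : ∀ n {f g : Cube n → ℕ} → (∀ t → f t ≡ g t) → sumCube n f ≡ sumCube n g
sumCube-cong zero    f≗g = f≗g []
sumCube-cong (suc n) f≗g = cong₂ _+_ (sumCube-cong n (f≗g ∘ (false ∷_))) (sumCube-cong n (f≗g ∘ (true ∷_)))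

sumCube-zero : ∀ n → sumCube n (λ _ → 0) ≡ 0
sumCube-zero zero    = refl
sumCube-zero (suc n) = cong₂ _+_ (sumCube-zero n) (sumCube-zero n)

sumCube-+ : ∀ n (f g : Cube n → ℕ) → sumCube n (λ t → f t + g t) ≡ sumCube n f + sumCube n g
sumCube-+ zero    f g = refl
sumCube-+ (suc n) f g =
  trans (cong₂ _+_ (sumCube-+ n (f ∘ (false ∷_)) (g ∘ (false ∷_))) (sumCube-+ n (f ∘ (true ∷_)) (g ∘ (true ∷_))))
        (+-interchange (sumCube n (f ∘ (false ∷_))) (sumCube n (g ∘ (false ∷_))) _ _)

sumCube-⊕ : ∀ n (x : Cube n) (g : Cube n → ℕ) → sumCube n (g ∘ (x ⊕_)) ≡ sumCube n g
sumCube-⊕ zero    []          g = refl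
sumCube-⊕ (suc n) (false ∷ x) g =
  cong₂ _+_ (sumCube-⊕ n x (g ∘ (false ∷_))) (sumCube-⊕ n x (g ∘ (true ∷_)))
sumCube-⊕ (suc n) (true ∷ x)  g =
  trans (cong₂ _+_ (sumCube-⊕ n x (g ∘ (true ∷_))) (sumCube-⊕ n x (g ∘ (false ∷_))))
        (+-comm (sumCube n (g ∘ (true ∷_))) (sumCube n (g ∘ (false ∷_))))

-- `≡-dec` computes `does` coordinatewise, so the indicator of a mismatched head bit is 0 by evaluation.
sumCube-indicator-≡ : ∀ n (u : Cube n) → sumCube n (λ t → indicator (t ≟ᶜ u)) ≡ 1
sumCube-indicator-≡ zero    []          = refl
sumCube-indicator-≡ (suc n) (false ∷ u) = cong₂ _+_ (sumCube-indicator-≡ n u) (sumCube-zero n)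
sumCube-indicator-≡ (suc n) (true ∷ u)  = cong₂ _+_ (sumCube-zero n) (sumCube-indicator-≡ n u)

sumCube-indicator-∈ : ∀ n {U : List (Cube n)} → Unique U → sumCube n (λ t → indicator (t ∈? U)) ≡ length U
sumCube-indicator-∈ n {[]}    []         = sumCube-zero n
sumCube-indicator-∈ n {u ∷ U} (u≢U ∷ U!) = begin
  sumCube n (λ t → indicator (t ∈? u ∷ U))
    ≡⟨ sumCube-cong n (indicator-∈-∷ _≟ᶜ_ (All.All¬⇒¬Any u≢U)) ⟩
  sumCube n (λ t → indicator (t ≟ᶜ u) + indicator (t ∈? U))
    ≡⟨ sumCube-+ n _ _ ⟩
  sumCube n (λ t → indicator (t ≟ᶜ u)) + sumCube n (λ t → indicator (t ∈? U))
    ≡⟨ cong₂ _+_ (sumCube-indicator-≡ n u) (sumCube-indicator-∈ n U!) ⟩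
  suc (length U) ∎
  where open ≡-Reasoning

∃-below-average : ∀ n (g : Cube n → ℕ) → ∃ λ t → 2 ^ n * g t ≤ sumCube n g
∃-below-average zero    g = [] , ≤-reflexive (*-identityˡ (g []))
∃-below-average (suc n) g
  with ∃-below-average n (g ∘ (false ∷_)) | ∃-below-average n (g ∘ (true ∷_))
... | t₀ , below₀ | t₁ , below₁ with g (false ∷ t₀) ≤? g (true ∷ t₁)
... | yes ≤₁ = false ∷ t₀ , twice-≤-+ (2 ^ n) ≤₁ below₀ below₁
... | no  ≰₁ = true ∷ t₁ , subst (2 ^ suc n * g (true ∷ t₁) ≤_) (+-comm (sumCube n (g ∘ (true ∷_))) _)
                                 (twice-≤-+ (2 ^ n) (≰⇒≥ ≰₁) below₁ below₀)

overlapSize : ∀ {n} → List (Cube n) → List (Cube n) → Cube n → ℕ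
overlapSize I U t = length (filter (_∈? U) (map (_⊕ t) I))

sumCube-overlapSize : ∀ {n} (I : List (Cube n)) {U} → Unique U →
  sumCube n (overlapSize I U) ≡ length I * length U
sumCube-overlapSize {n} []      U! = sumCube-zero n
sumCube-overlapSize {n} (x ∷ I) {U} U! = begin
  sumCube n (overlapSize (x ∷ I) U)
    ≡⟨ sumCube-cong n (λ t → length-filter-∷ (_∈? U) (x ⊕ t) (map (_⊕ t) I)) ⟩
  sumCube n (λ t → indicator (x ⊕ t ∈? U) + overlapSize I U t)
    ≡⟨ sumCube-+ n _ _ ⟩
  sumCube n (λ t → indicator (x ⊕ t ∈? U)) + sumCube n (overlapSize I U)
    ≡⟨ cong₂ _+_ (trans (sumCube-⊕ n x _) (sumCube-indicator-∈ n U!)) (sumCube-overlapSize I U!) ⟩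
  length U + length I * length U ∎
  where open ≡-Reasoning

size-bound-step : ∀ N {k u c f} j → c + f ≡ k → N * c ≤ k * u → u ≤ j * k →
  2 * N * j * k ≤ 2 * N * u + j * (j ∸ 1) * (k * k) →
  2 * N * suc j * k ≤ 2 * N * (u + f) + suc j * j * (k * k)
size-bound-step N {u = u} {c} {f} j refl Nc≤ku u≤jk bound = begin
  2 * N * suc j * k
    ≡⟨ split N j c f ⟩
  2 * N * j * k + 2 * N * f + 2 * (N * c)
    ≤⟨ +-mono-≤ (+-monoˡ-≤ (2 * N * f) bound) (*-monoʳ-≤ 2 (≤-trans Nc≤ku (*-monoʳ-≤ k u≤jk))) ⟩
  2 * N * u + j * (j ∸ 1) * (k * k) + 2 * N * f + 2 * (k * (j * k))
    ≡⟨ regroup N u f k j (j * (j ∸ 1)) ⟩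
  2 * N * (u + f) + (j * (j ∸ 1) + 2 * j) * (k * k)
    ≡⟨ cong (λ m → 2 * N * (u + f) + m * (k * k)) (pairs-suc j) ⟩
  2 * N * (u + f) + suc j * j * (k * k) ∎
  where
  open ≤-Reasoning
  k = c + f
  split : ∀ N j c f → 2 * N * suc j * (c + f) ≡ 2 * N * j * (c + f) + 2 * N * f + 2 * (N * c)
  split = solve-∀
  regroup : ∀ N u f k j m →
    2 * N * u + m * (k * k) + 2 * N * f + 2 * (k * (j * k)) ≡ 2 * N * (u + f) + (m + 2 * j) * (k * k)
  regroup = solve-∀
  pairs-suc : ∀ j → j * (j ∸ 1) + 2 * j ≡ suc j * j
  pairs-suc zero    = refl
  pairs-suc (suc j) = expand j
    where
    expand : ∀ j → suc j * j + 2 * suc j ≡ suc (suc j) * suc j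
    expand = solve-∀

module Greedy {n} (D : List ℕ) (I : List (Cube n)) (I! : Unique I) (I-indep : Independent D I) where

  k : ℕ
  k = length I

  -- size≥ is |U| ≥ j k (1 - (j - 1) k / 2^(n+1)) with the denominator cleared.
  record Stage (j : ℕ) : Set where
    field
      vertices      : List (Cube n)
      unique        : Unique vertices
      cliqueNumber≤ : CliqueNumber≤ (Adj D) j vertices
      size≤         : length vertices ≤ j * k
      size≥         : 2 * 2 ^ n * j * k ≤ 2 * 2 ^ n * length vertices + j * (j ∸ 1) * (k * k)

  initial : Stage 0
  initial = record
    { vertices      = []
    ; unique        = []
    ; cliqueNumber≤ = cliqueNumber≤-[] (Adj D)
    ; size≤         = z≤n
    ; size≥         = subst (_≤ 2 * 2 ^ n * 0 + 0) (sym (cong (_* k) (*-zeroʳ (2 * 2 ^ n)))) z≤n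
    }

  extend : ∀ {j} → Stage j → Stage (suc j)
  extend {j} S = record
    { vertices      = U ++ fresh
    ; unique        = Unique.++⁺ unique (Unique.filter⁺ (_∉? U) (Unique.map⁺ (⊕-cancelʳ t) I!))
                        (λ (v∈U , v∈fresh) → proj₂ (∈-filter⁻ (_∉? U) {xs = T} v∈fresh) v∈U)
    ; cliqueNumber≤ = subst (λ m → CliqueNumber≤ (Adj D) m (U ++ fresh)) (+-comm j 1)
                        (cliqueNumber≤-++ (Adj D) _≟ᶜ_ cliqueNumber≤
                          (independent⇒cliqueNumber≤1 (Adj D) fresh-independent))
    ; size≤         = begin
        length (U ++ fresh)     ≡⟨ length-++ U ⟩
        length U + length fresh ≤⟨ +-mono-≤ size≤ (subst (length fresh ≤_) overlap+fresh (m≤n+m _ _)) ⟩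
        j * k + k               ≡⟨ +-comm (j * k) k ⟩
        suc j * k               ∎
    ; size≥         = subst (λ m → 2 * 2 ^ n * suc j * k ≤ 2 * 2 ^ n * m + suc j * j * (k * k))
                        (sym (length-++ U))
                        (size-bound-step (2 ^ n) j overlap+fresh overlap-small size≤ size≥)
    }
    where
    open Stage S renaming (vertices to U)
    open ≤-Reasoning
    best : ∃ λ t → 2 ^ n * overlapSize I U t ≤ sumCube n (overlapSize I U)
    best = ∃-below-average n (overlapSize I U)
    t = proj₁ best
    T = map (_⊕ t) I
    fresh = filter (_∉? U) T
    overlap-small : 2 ^ n * overlapSize I U t ≤ k * length U
    overlap-small = ≤-trans (proj₂ best) (≤-reflexive (sumCube-overlapSize I unique))
    overlap+fresh : overlapSize I U t + length fresh ≡ k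
    overlap+fresh = trans (length-filter-+-filter-∁ (_∈? U) T) (length-map (_⊕ t) I)
    fresh-independent : Independent D fresh
    fresh-independent v∈ w∈ = independent-map-⊕ I-indep t
      (proj₁ (∈-filter⁻ (_∉? U) {xs = T} v∈)) (proj₁ (∈-filter⁻ (_∉? U) {xs = T} w∈))

  stage : ∀ j → Stage j
  stage zero    = initial
  stage (suc j) = extend (stage j)

-- DistSet is unused and 3 ≤ s only excludes s = 0: the bound holds for every D and s ≥ 1.
lemma3p3 : (n : ℕ) (D : List ℕ) → DistSet n D →
    (I : List (Cube n)) → Unique I → Independent D I →
    (s : ℕ) → 3 ≤ s →
    Σ (List (Cube n)) λ S → Unique S × ¬ ContainsK D s S ×
      2 * 2 ^ n * (s ∸ 1) * length I
        ≤ 2 * 2 ^ n * length S + (s ∸ 1) * (s ∸ 2) * (length I * length I)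
lemma3p3 n D _ I I! I-indep zero    ()
lemma3p3 n D _ I I! I-indep (suc j) _ =
  vertices , unique , cliqueNumber≤⇒¬ContainsK cliqueNumber≤ , size≥
  where open Greedy.Stage (Greedy.stage D I I! I-indep j)
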